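{- For $n\ge1$, there is a bijection between the set of inversion sequences $e\in\mathbf{I}_n$ with no index $i$ such that $e_i\ge e_{i+1}\le e_{i+2}$, and the set of compositions of $n$ with all parts in $\{1,2\}$. In particular, the number of such inversion sequences is $F_{n+1}$.
   Context: An inversion sequence of length $n$ is an integer sequence $e=e_1\dots e_n$ with $0\le e_i<i$ for all $i$; $\mathbf{I}_n$ is the set of these. A composition of $n$ with parts in $\{1,2\}$ is a sequence $(a_1,\dots,a_j)$ with $a_i\in\{1,2\}$ and $a_1+\dots+a_j=n$. $F_m$ are Fibonacci numbers: $F_0=0$, $F_1=1$, $F_m=F_{m-1}+F_{m-2}$. (In the paper's notation the set is $\mathbf{I}_n(\underline{\geq,\leq})$.) -}

module Defs where

open import Data.Nat using (ℕ; zero; suc; _+_; _<_; _≤_; _≥_; _≤ᵇ_)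
open import Data.Bool using (Bool; true; false; _∧_; not)
open import Data.List using (List; []; _∷_; length)
open import Data.Nat.ListAction using (sum)
open import Data.List.Relation.Unary.All using (All)
open import Data.Product using (Σ; _×_)
open import Relation.Binary.PropositionalEquality using (_≡_)
open import Data.Sum using (_⊎_)

-- `isInvSeqFrom k e` : e = e_{k+1} e_{k+2} … (entries at positions k+1, k+2, …)
-- satisfies 0 ≤ e_i < i at every position i.
isInvSeqFrom : ℕ → List ℕ → Bool
isInvSeqFrom k []       = true
isInvSeqFrom k (x ∷ xs) = (suc x ≤ᵇ suc k) ∧ isInvSeqFrom (suc k) xs

IsInvSeq : ℕ → List ℕ → Set
IsInvSeq n e = (length e ≡ n) × (isInvSeqFrom 0 e ≡ true)

hasPattern : List ℕ → Bool
hasPattern (a ∷ b ∷ c ∷ rest) = ((b ≤ᵇ a) ∧ (b ≤ᵇ c)) Data.Bool.∨ hasPattern (b ∷ c ∷ rest)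
hasPattern _ = false

-- The set I_n(≥,≤) of inversion sequences of length n avoiding the consecutive pattern:
-- forward-order lists e = e_1 … e_n with 0 ≤ e_i < i and no i with e_i ≥ e_{i+1} ≤ e_{i+2}.
-- (Boolean/ℕ-equality conditions, so the carrier has decidable equality and proof-irrelevant witnesses.)
AvoidingInvSeq : ℕ → Set
AvoidingInvSeq n =
  Σ (List ℕ) λ e → IsInvSeq n e × (hasPattern e ≡ false)

IsOneOrTwo : ℕ → Set
IsOneOrTwo a = (a ≡ 1) ⊎ (a ≡ 2)

Comp12 : ℕ → Set
Comp12 n = Σ (List ℕ) λ as → All IsOneOrTwo as × (sum as ≡ n)

fib : ℕ → ℕ
fib 0 = 0
fib 1 = 1
fib (suc (suc m)) = fib (suc m) + fib m

module Submission where

-- An inversion sequence avoids the pattern iff it is a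
-- staircase 0,1,…,m-1 (every entry maximal) followed by a strictly
-- decreasing tail D of entries below m.  The decomposition is unique.
-- Such a tail is the same as a subset of {0,…,m-1}, i.e. a bit string of
-- length m; the sequence has length m + |D|, so reading a bit as a part 2
-- when it is set and as a part 1 otherwise gives a composition of that
-- length with parts in {1,2}.
--
-- Bit
-- strings are in bijection with 1/2-compositions, and they satisfy the
-- Fibonacci recursion, which yields the count F_{n+1}.

open import Defs
open import Data.Nat using (ℕ; zero; suc; _≥_; _+_; _≤_; _<_; _≤ᵇ_; s≤s)
open import Data.Nat.Properties
  using (≤ᵇ⇒≤; ≤⇒≤ᵇ; ≰⇒>; <⇒≱; _≟_; ≤-refl; ≤-trans; <⇒≤; ≤-pred; n<1+n; m≤n⇒m≤1+n;
         m≤n⇒m<n∨m≡n; ≤∧≢⇒<; <-irrefl; +-suc; +-identityʳ; suc-injective; ≡-irrelevant)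
open import Data.Fin using (Fin; zero)
open import Data.Fin.Properties using (+↔⊎)
open import Data.Bool using (Bool; true; false; _∧_)
open import Data.Bool.Properties using (T-≡; not-¬; ∧-zeroʳ; ∧-conicalˡ; ∧-conicalʳ; ∨-conicalˡ; ∨-conicalʳ)
import Data.Bool.Properties as Bool
open import Data.List using (List; []; _∷_; length; _++_; map)
open import Data.List.Properties using (length-++; ∷-injectiveʳ)
open import Data.Nat.ListAction using (sum)
open import Data.List.Relation.Unary.All using (All; []; _∷_)
import Data.List.Relation.Unary.All as All
open import Data.Product using (_×_; _,_; Σ; proj₁; proj₂)
open import Data.Sum using (_⊎_; inj₁; inj₂)
open import Data.Empty using (⊥-elim)
open import Relation.Nullary using (yes; no; ¬_)
open import Relation.Unary using (Irrelevant)
open import Relation.Binary.PropositionalEquality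
open import Function.Bundles using (_⤖_; _↔_; mk↔ₛ′; Equivalence)
open import Function.Properties.Inverse using (↔⇒⤖; ↔-trans; ↔-sym)
open import Data.Sum.Function.Propositional using (_⊎-cong_)
open import Axiom.UniquenessOfIdentityProofs using (module Decidable⇒UIP)

≤ᵇ-true : ∀ {m n} → m ≤ n → (m ≤ᵇ n) ≡ true
≤ᵇ-true m≤n = Equivalence.to T-≡ (≤⇒≤ᵇ m≤n)

≤ᵇ-true⁻ : ∀ {m n} → (m ≤ᵇ n) ≡ true → m ≤ n
≤ᵇ-true⁻ {m} {n} eq = ≤ᵇ⇒≤ m n (Equivalence.from T-≡ eq)

≤ᵇ-false : ∀ {m n} → n < m → (m ≤ᵇ n) ≡ false
≤ᵇ-false {m} {n} n<m with m ≤ᵇ n in eq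
... | false = refl
... | true  = ⊥-elim (<⇒≱ n<m (≤ᵇ-true⁻ eq))

≤ᵇ-false⁻ : ∀ {m n} → (m ≤ᵇ n) ≡ false → n < m
≤ᵇ-false⁻ eq = ≰⇒> λ m≤n → not-¬ eq (≤ᵇ-true m≤n)

ascent-skip : ∀ {a b} rest → a < b → hasPattern (a ∷ b ∷ rest) ≡ hasPattern (b ∷ rest)
ascent-skip []       a<b = refl
ascent-skip (c ∷ cs) a<b rewrite ≤ᵇ-false a<b = refl

descent-skip : ∀ {a b c} rest → c < b → hasPattern (a ∷ b ∷ c ∷ rest) ≡ hasPattern (b ∷ c ∷ rest)
descent-skip {a} {b} rest c<b rewrite ≤ᵇ-false c<b | ∧-zeroʳ (b ≤ᵇ a) = refl

descent-forced : ∀ {a b c} rest → b ≤ a → hasPattern (a ∷ b ∷ c ∷ rest) ≡ false →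
                 c < b × hasPattern (b ∷ c ∷ rest) ≡ false
descent-forced {b = b} {c} rest b≤a avoid rewrite ≤ᵇ-true b≤a =
  ≤ᵇ-false⁻ (∨-conicalˡ (b ≤ᵇ c) _ avoid) , ∨-conicalʳ _ _ avoid

data Descending : ℕ → List ℕ → Set where
  nil  : ∀ {x} → Descending x []
  cons : ∀ {x y ys} → y < x → Descending y ys → Descending x (y ∷ ys)

descending-weaken : ∀ {x x' ys} → x ≤ x' → Descending x ys → Descending x' ys
descending-weaken x≤x' nil            = nil
descending-weaken x≤x' (cons y<x ys↓) = cons (≤-trans y<x x≤x') ys↓

descending-avoids : ∀ a {x ys} → Descending x ys → hasPattern (a ∷ x ∷ ys) ≡ false
descending-avoids a nil            = refl
descending-avoids a {x} (cons {ys = ys} y<x ys↓) = trans (descent-skip ys y<x) (descending-avoids x ys↓)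

descending-inv : ∀ {x ys} k → Descending x ys → x ≤ k → isInvSeqFrom k ys ≡ true
descending-inv k nil            x≤k = refl
descending-inv k (cons {y = y} y<x ys↓) x≤k =
  cong₂ _∧_ (≤ᵇ-true (s≤s y≤k)) (descending-inv (suc k) ys↓ (m≤n⇒m≤1+n y≤k))
  where
  y≤k : y ≤ k
  y≤k = ≤-trans (<⇒≤ y<x) x≤k

avoids→descending : ∀ {a x} ys → x ≤ a → hasPattern (a ∷ x ∷ ys) ≡ false → Descending x ys
avoids→descending []       x≤a avoid = nil
avoids→descending (y ∷ ys) x≤a avoid =
  let y<x , avoid' = descent-forced ys x≤a avoid
  in cons y<x (avoids→descending ys (<⇒≤ y<x) avoid')

-- `Shape k xs`: xs may follow the staircase 0,1,…,k-1 in an avoiding inversion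
-- sequence.
data Shape : ℕ → List ℕ → Set where
  stop  : ∀ {k} → Shape k []
  climb : ∀ {k xs} → Shape (suc k) xs → Shape k (k ∷ xs)
  fall  : ∀ {k x xs} → x < k → Descending x xs → Shape k (x ∷ xs)

-- xs, placed after the staircase e_1 … e_{j+1} = 0,…,j, satisfies the
-- inversion-sequence bounds and creates no occurrence of the pattern.
ValidAfter : ℕ → List ℕ → Set
ValidAfter j xs = (isInvSeqFrom (suc j) xs ≡ true) × (hasPattern (j ∷ xs) ≡ false)

Valid : List ℕ → Set
Valid e = (isInvSeqFrom 0 e ≡ true) × (hasPattern e ≡ false)

shape→valid : ∀ {j xs} → Shape (suc j) xs → ValidAfter j xs
shape→valid stop = refl , refl
shape→valid {j} (climb {xs = ys} shape) =
  let inv , avoid = shape→valid shape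
  in cong₂ _∧_ (≤ᵇ-true (≤-refl {suc (suc j)})) inv , trans (ascent-skip ys (n<1+n j)) avoid
shape→valid {j} (fall x<k xs↓) =
  cong₂ _∧_ (≤ᵇ-true (s≤s (<⇒≤ x<k))) (descending-inv (suc (suc j)) xs↓ (m≤n⇒m≤1+n (<⇒≤ x<k))) ,
  descending-avoids j xs↓

valid→shape : ∀ j xs → ValidAfter j xs → Shape (suc j) xs
valid→shape j []       _             = stop
valid→shape j (x ∷ ys) (inv , avoid) with m≤n⇒m<n∨m≡n (≤-pred (≤ᵇ-true⁻ (∧-conicalˡ _ _ inv)))
... | inj₁ x<k  = fall x<k (avoids→descending ys (≤-pred x<k) avoid)
... | inj₂ refl =
  climb (valid→shape (suc j) ys (∧-conicalʳ _ _ inv , trans (sym (ascent-skip ys (n<1+n j))) avoid))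

shape₀→valid : ∀ {e} → Shape 0 e → Valid e
shape₀→valid stop          = refl , refl
shape₀→valid (climb shape) = shape→valid shape

valid→shape₀ : ∀ e → Valid e → Shape 0 e
valid→shape₀ []           _             = stop
valid→shape₀ (zero ∷ ys)  (inv , avoid) = climb (valid→shape 0 ys (inv , avoid))
valid→shape₀ (suc x ∷ ys) (() , _)

staircase : ℕ → ℕ → List ℕ
staircase k zero    = []
staircase k (suc m) = k ∷ staircase (suc k) m

length-staircase : ∀ k m → length (staircase k m) ≡ m
length-staircase k zero    = refl
length-staircase k (suc m) = cong suc (length-staircase (suc k) m)

shift : ∀ k m {D} → Descending (k + suc m) D → Descending (suc k + m) D
shift k m {D} = subst (λ b → Descending b D) (+-suc k m)

unshift : ∀ k m {D} → Descending (suc k + m) D → Descending (k + suc m) D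
unshift k m {D} = subst (λ b → Descending b D) (sym (+-suc k m))

from-+0 : ∀ k {D} → Descending (k + zero) D → Descending k D
from-+0 k {D} = subst (λ b → Descending b D) (+-identityʳ k)

to-+0 : ∀ k {D} → Descending k D → Descending (k + zero) D
to-+0 k {D} = subst (λ b → Descending b D) (sym (+-identityʳ k))

not-top : ∀ k {ys} → ¬ Descending (k + zero) (k ∷ ys)
not-top k ys↓ with from-+0 k ys↓
... | cons k<k _ = <-irrefl refl k<k

record StaircaseSplit (k : ℕ) (xs : List ℕ) : Set where
  field
    height : ℕ
    tail   : List ℕ
    splits : xs ≡ staircase k height ++ tail
    tail↓  : Descending (k + height) tail

decompose : ∀ {k xs} → Shape k xs → StaircaseSplit k xs
decompose stop = record { height = 0 ; tail = [] ; splits = refl ; tail↓ = nil }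
decompose {k} (climb shape) =
  let open StaircaseSplit (decompose shape)
  in record { height = suc height ; tail = tail ; splits = cong (k ∷_) splits
            ; tail↓ = unshift k height tail↓ }
decompose {k} (fall x<k xs↓) =
  record { height = 0 ; tail = _ ; splits = refl
         ; tail↓ = to-+0 k (cons x<k xs↓) }

compose : ∀ k m {D} → Descending (k + m) D → Shape k (staircase k m ++ D)
compose k zero    {[]}    _   = stop
compose k zero    {x ∷ _} D↓ with from-+0 k D↓
... | cons x<k xs↓ = fall x<k xs↓
compose k (suc m) D↓ = climb (compose (suc k) m (shift k m D↓))

-- The split is unique: the tail cannot begin with the next staircase value.
split-unique : ∀ k m m' {D D'} → Descending (k + m) D → Descending (k + m') D' →
               staircase k m ++ D ≡ staircase k m' ++ D' → m ≡ m' × D ≡ D'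
split-unique k zero     zero      D↓ D'↓ eq = refl , eq
split-unique k zero     (suc m')  D↓ D'↓ eq = ⊥-elim (not-top k (subst (Descending (k + 0)) eq D↓))
split-unique k (suc m)  zero      D↓ D'↓ eq = ⊥-elim (not-top k (subst (Descending (k + 0)) (sym eq) D'↓))
split-unique k (suc m)  (suc m')  D↓ D'↓ eq =
  let m≡m' , D≡D' = split-unique (suc k) m m' (shift k m D↓) (shift k m' D'↓) (∷-injectiveʳ eq)
  in cong suc m≡m' , D≡D'

-- Subsets of {0,…,m-1} as bit strings of length m, read from m-1 down to 0.
-- `positions bs` lists the set bits (a bit followed by i more bits has position i)
-- in decreasing order; `indicator j D` is the bit string of D ⊆ {0,…,j-1}.

positions : List Bool → List ℕ
positions []           = []
positions (true ∷ bs)  = length bs ∷ positions bs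
positions (false ∷ bs) = positions bs

indicator : ℕ → List ℕ → List Bool
indicator zero    _        = []
indicator (suc i) []       = false ∷ indicator i []
indicator (suc i) (x ∷ xs) with x ≟ i
... | yes _ = true ∷ indicator i xs
... | no  _ = false ∷ indicator i (x ∷ xs)

length-indicator : ∀ j D → length (indicator j D) ≡ j
length-indicator zero    D        = refl
length-indicator (suc i) []       = cong suc (length-indicator i [])
length-indicator (suc i) (x ∷ xs) with x ≟ i
... | yes _ = cong suc (length-indicator i xs)
... | no  _ = cong suc (length-indicator i (x ∷ xs))

positions-descending : ∀ bs → Descending (length bs) (positions bs)
positions-descending []           = nil
positions-descending (true ∷ bs)  = cons (n<1+n _) (positions-descending bs)
positions-descending (false ∷ bs) = descending-weaken (m≤n⇒m≤1+n ≤-refl) (positions-descending bs)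

positions-indicator : ∀ j D → Descending j D → positions (indicator j D) ≡ D
positions-indicator zero    []       _              = refl
positions-indicator zero    (x ∷ xs) (cons () _)
positions-indicator (suc i) []       _              = positions-indicator i [] nil
positions-indicator (suc i) (x ∷ xs) (cons x<j xs↓) with x ≟ i
... | yes refl = cong₂ _∷_ (length-indicator i xs) (positions-indicator i xs xs↓)
... | no  x≢i  = positions-indicator i (x ∷ xs) (cons (≤∧≢⇒< (≤-pred x<j) x≢i) xs↓)

indicator-clear : ∀ L D → Descending L D → indicator (suc L) D ≡ false ∷ indicator L D
indicator-clear L []       _              = refl
indicator-clear L (x ∷ xs) (cons x<L _) with x ≟ L
... | yes refl = ⊥-elim (<-irrefl refl x<L)
... | no  _    = refl

indicator-positions : ∀ bs → indicator (length bs) (positions bs) ≡ bs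
indicator-positions []           = refl
indicator-positions (true ∷ bs)  with length bs ≟ length bs
... | yes _   = cong (true ∷_) (indicator-positions bs)
... | no  ≢bs = ⊥-elim (≢bs refl)
indicator-positions (false ∷ bs) =
  trans (indicator-clear _ _ (positions-descending bs)) (cong (false ∷_) (indicator-positions bs))

part : Bool → ℕ
part true  = 2
part false = 1

weight : List Bool → ℕ
weight bs = sum (map part bs)

Bits : ℕ → Set
Bits n = Σ (List Bool) λ bs → weight bs ≡ n

weight-length : ∀ bs → weight bs ≡ length bs + length (positions bs)
weight-length []           = refl
weight-length (true ∷ bs)  = cong suc (trans (cong suc (weight-length bs)) (sym (+-suc _ _)))
weight-length (false ∷ bs) = cong suc (weight-length bs)

encode : List Bool → List ℕ
encode bs = staircase 0 (length bs) ++ positions bs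

length-encode : ∀ bs → length (encode bs) ≡ weight bs
length-encode bs = begin
  length (staircase 0 (length bs) ++ positions bs)        ≡⟨ length-++ (staircase 0 (length bs)) ⟩
  length (staircase 0 (length bs)) + length (positions bs) ≡⟨ cong (_+ length (positions bs)) (length-staircase 0 (length bs)) ⟩
  length bs + length (positions bs)                       ≡⟨ sym (weight-length bs) ⟩
  weight bs                                               ∎
  where open ≡-Reasoning

encode-shape : ∀ bs → Shape 0 (encode bs)
encode-shape bs = compose 0 (length bs) (positions-descending bs)

decode : ∀ {e} → Shape 0 e → List Bool
decode shape = indicator height tail
  where open StaircaseSplit (decompose shape)

-- encode undoes decode on avoiding sequences and, by uniqueness of the
-- staircase split, decode undoes encode.
encode-decode : ∀ {e} (shape : Shape 0 e) → encode (decode shape) ≡ e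
encode-decode {e} shape = begin
  staircase 0 (length (indicator height tail)) ++ positions (indicator height tail)
    ≡⟨ cong₂ _++_ (cong (staircase 0) (length-indicator height tail)) (positions-indicator height tail tail↓) ⟩
  staircase 0 height ++ tail
    ≡⟨ sym splits ⟩
  e ∎
  where
  open StaircaseSplit (decompose shape)
  open ≡-Reasoning

decode-encode : ∀ bs (shape : Shape 0 (encode bs)) → decode shape ≡ bs
decode-encode bs shape = begin
  indicator height tail                   ≡⟨ cong₂ indicator (sym length≡height) (sym positions≡tail) ⟩
  indicator (length bs) (positions bs)    ≡⟨ indicator-positions bs ⟩
  bs                                      ∎
  where
  open StaircaseSplit (decompose shape)
  open ≡-Reasoning
  length≡height : length bs ≡ height
  length≡height = proj₁ (split-unique 0 (length bs) height (positions-descending bs) tail↓ splits)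
  positions≡tail : positions bs ≡ tail
  positions≡tail = proj₂ (split-unique 0 (length bs) height (positions-descending bs) tail↓ splits)

Σ-≡ : {A : Set} {P : A → Set} {a a' : A} {p : P a} {p' : P a'} →
      a ≡ a' → Irrelevant P → _≡_ {A = Σ A P} (a , p) (a' , p')
Σ-≡ refl irr = cong (_ ,_) (irr _ _)

bool-irrelevant : {a b : Bool} → (p q : a ≡ b) → p ≡ q
bool-irrelevant = Decidable⇒UIP.≡-irrelevant Bool._≟_

avoiding↔bits : ∀ n → AvoidingInvSeq n ↔ Bits n
avoiding↔bits n = mk↔ₛ′ to from to∘from from∘to
  where
  shapeOf : (a : AvoidingInvSeq n) → Shape 0 (proj₁ a)
  shapeOf (e , (_ , inv) , avoid) = valid→shape₀ e (inv , avoid)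

  to : AvoidingInvSeq n → Bits n
  to a@(_ , (len , _) , _) =
    decode (shapeOf a) ,
    trans (sym (length-encode (decode (shapeOf a)))) (trans (cong length (encode-decode (shapeOf a))) len)

  from : Bits n → AvoidingInvSeq n
  from (bs , w) = encode bs , (trans (length-encode bs) w , proj₁ valid) , proj₂ valid
    where
    valid : Valid (encode bs)
    valid = shape₀→valid (encode-shape bs)

  to∘from : ∀ b → to (from b) ≡ b
  to∘from b@(bs , _) = Σ-≡ (decode-encode bs (shapeOf (from b))) ≡-irrelevant

  from∘to : ∀ a → from (to a) ≡ a
  from∘to a = Σ-≡ (encode-decode (shapeOf a)) λ { ((l , i) , p) ((l' , i') , p') →
    cong₂ _,_ (cong₂ _,_ (≡-irrelevant l l') (bool-irrelevant i i')) (bool-irrelevant p p') }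

parts-12 : ∀ bs → All IsOneOrTwo (map part bs)
parts-12 []           = []
parts-12 (true ∷ bs)  = inj₂ refl ∷ parts-12 bs
parts-12 (false ∷ bs) = inj₁ refl ∷ parts-12 bs

bitsOf : ∀ {as} → All IsOneOrTwo as → List Bool
bitsOf []            = []
bitsOf (inj₁ _ ∷ ps) = false ∷ bitsOf ps
bitsOf (inj₂ _ ∷ ps) = true ∷ bitsOf ps

parts-bitsOf : ∀ {as} (ps : All IsOneOrTwo as) → map part (bitsOf ps) ≡ as
parts-bitsOf []               = refl
parts-bitsOf (inj₁ refl ∷ ps) = cong (1 ∷_) (parts-bitsOf ps)
parts-bitsOf (inj₂ refl ∷ ps) = cong (2 ∷_) (parts-bitsOf ps)

bitsOf-parts : ∀ bs → bitsOf (parts-12 bs) ≡ bs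
bitsOf-parts []           = refl
bitsOf-parts (true ∷ bs)  = cong (true ∷_) (bitsOf-parts bs)
bitsOf-parts (false ∷ bs) = cong (false ∷_) (bitsOf-parts bs)

oneOrTwo-irrelevant : Irrelevant IsOneOrTwo
oneOrTwo-irrelevant (inj₁ p) (inj₁ q) = cong inj₁ (≡-irrelevant p q)
oneOrTwo-irrelevant (inj₂ p) (inj₂ q) = cong inj₂ (≡-irrelevant p q)
oneOrTwo-irrelevant (inj₁ refl) (inj₂ ())
oneOrTwo-irrelevant (inj₂ refl) (inj₁ ())

bits↔comp12 : ∀ n → Bits n ↔ Comp12 n
bits↔comp12 n = mk↔ₛ′ to from to∘from from∘to
  where
  to : Bits n → Comp12 n
  to (bs , w) = map part bs , parts-12 bs , w

  from : Comp12 n → Bits n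
  from (as , ps , s) = bitsOf ps , trans (cong sum (parts-bitsOf ps)) s

  to∘from : ∀ c → to (from c) ≡ c
  to∘from (as , ps , s) = Σ-≡ (parts-bitsOf ps) λ { (q , t) (q' , t') →
    cong₂ _,_ (All.irrelevant oneOrTwo-irrelevant q q') (≡-irrelevant t t') }

  from∘to : ∀ b → from (to b) ≡ b
  from∘to (bs , w) = Σ-≡ (bitsOf-parts bs) ≡-irrelevant

-- Fibonacci recursion: a bit string of weight n+2 starts with a clear bit
-- (rest of weight n+1) or a set bit (rest of weight n).

bits-split : ∀ n → Bits (suc (suc n)) ↔ (Bits (suc n) ⊎ Bits n)
bits-split n = mk↔ₛ′ to from to∘from from∘to
  where
  to : Bits (suc (suc n)) → Bits (suc n) ⊎ Bits n
  to (false ∷ bs , w) = inj₁ (bs , suc-injective w)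
  to (true ∷ bs , w)  = inj₂ (bs , suc-injective (suc-injective w))

  from : Bits (suc n) ⊎ Bits n → Bits (suc (suc n))
  from (inj₁ (bs , w)) = false ∷ bs , cong suc w
  from (inj₂ (bs , w)) = true ∷ bs , cong (λ m → suc (suc m)) w

  to∘from : ∀ b → to (from b) ≡ b
  to∘from (inj₁ (bs , w)) = cong (λ w' → inj₁ (bs , w')) (≡-irrelevant _ _)
  to∘from (inj₂ (bs , w)) = cong (λ w' → inj₂ (bs , w')) (≡-irrelevant _ _)

  from∘to : ∀ b → from (to b) ≡ b
  from∘to (false ∷ bs , w) = cong (false ∷ bs ,_) (≡-irrelevant _ _)
  from∘to (true ∷ bs , w)  = cong (true ∷ bs ,_) (≡-irrelevant _ _)

bits₀ : Bits 0 ↔ Fin 1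
bits₀ = mk↔ₛ′ (λ _ → zero) (λ _ → [] , refl) (λ { zero → refl })
              (λ { ([] , refl) → refl ; (true ∷ _ , ()) ; (false ∷ _ , ()) })

bits₁ : Bits 1 ↔ Fin 1
bits₁ = mk↔ₛ′ (λ _ → zero) (λ _ → false ∷ [] , refl) (λ { zero → refl })
              (λ { (false ∷ [] , refl) → refl ; ([] , ()) ; (true ∷ _ , ())
                 ; (false ∷ true ∷ _ , ()) ; (false ∷ false ∷ _ , ()) })

bits↔fib : ∀ n → Bits n ↔ Fin (fib (suc n))
bits↔fib zero          = bits₀
bits↔fib (suc zero)    = bits₁
bits↔fib (suc (suc n)) =
  ↔-trans (bits-split n) (↔-trans (bits↔fib (suc n) ⊎-cong bits↔fib n) (↔-sym +↔⊎))

-- Proposition 4.8.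
proposition4p8 : (n : ℕ) → n ≥ 1 →
    (AvoidingInvSeq n ⤖ Comp12 n) × (AvoidingInvSeq n ↔ Fin (fib (suc n)))
proposition4p8 n _ =
  ↔⇒⤖ (↔-trans (avoiding↔bits n) (bits↔comp12 n)) ,
  ↔-trans (avoiding↔bits n) (bits↔fib n)
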